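{- Let $k \geq 2$ be an integer and let $G$ be a finite digraph on vertex set $V = S \cup T$ (with $S$, $T$ disjoint) such that the induced subdigraph $G[S]$ is strongly connected, $G[T]$ has no edges, and there are no edges from $T$ to $S$. Let $C_T: T \to \mathbb{N}$ be any colouring of $T$ and let $L: S \to \mathcal{P}(\mathbb{N})$ be an assignment of lists with $|L(v)| \geq k$ for each $v \in S$. Then there exists a colouring $C: V \to \mathbb{N}$ extending $C_T$ with $C(v) \in L(v)$ for each $v \in S$, such that no vertex $v \in S$ has more than $2d^+(v)/k$ out-neighbours with the same colour as $v$.
   Context: For a vertex $v$ of a digraph, $d^+(v)$ denotes its out-degree (in $G$) and an out-neighbour of $v$ is a vertex $w$ such that $vw$ is an edge from $v$ to $w$. Colourings need not be proper. -}

module Defs where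

open import Data.Nat using (ℕ; zero; suc; _+_; _≡ᵇ_)
open import Data.Fin using (Fin)
import Data.Fin as F
open import Data.Bool using (Bool; true; false; if_then_else_)
open import Relation.Binary.PropositionalEquality using (_≡_)
open import Relation.Nullary using (¬_)
open import Function using (Injective)
open import Data.Product using (Σ; _×_)

record Digraph (n : ℕ) : Set where
  field
    adj     : Fin n → Fin n → Bool
    loopless : ∀ v → adj v v ≡ false
open Digraph public

count : ∀ {n} → (Fin n → Bool) → ℕ
count {zero}  p = 0
count {suc n} p = (if p F.zero then 1 else 0) + count (λ i → p (F.suc i))

outdeg : ∀ {n} → Digraph n → Fin n → ℕ
outdeg G v = count (adj G v)

sameColOut : ∀ {n} → Digraph n → (Fin n → ℕ) → Fin n → ℕ
sameColOut G C v = count (λ w → if adj G v w then C w ≡ᵇ C v else false)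

data PathIn {n} (G : Digraph n) (S : Fin n → Bool) : Fin n → Fin n → Set where
  here : ∀ {u} → S u ≡ true → PathIn G S u u
  step : ∀ {u w v} → S u ≡ true → adj G u w ≡ true → PathIn G S w v → PathIn G S u v

StronglyConnectedOn : ∀ {n} → Digraph n → (Fin n → Bool) → Set
StronglyConnectedOn G S = ∀ u v → S u ≡ true → S v ≡ true → PathIn G S u v

AtLeast : ℕ → (ℕ → Set) → Set
AtLeast k L = Σ (Fin k → ℕ) (λ f → Injective _≡_ _≡_ f × (∀ i → L (f i)))

-- Give each vertex u of S a positive integer weight π u such that, at every v ∈ S, the
-- π-weighted number of edges entering v from S equals π v times the out-degree of v into S:
-- a rescaled stationary measure of the random walk on G[S]. It exists because G[S] is strongly
-- connected, and is built by eliminating one vertex at a time.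
-- The potential of a colouring is the sum of π u over monochromatic edges uw with u ∈ S. Its
-- part at v consists of π v times the out-conflicts of v and the π-weighted in-conflicts at v.
-- Summed over the k colours of L(v) these are at most π v d⁺(v) each, so if v has more than
-- 2d⁺(v)/k out-neighbours of its own colour, some colour of L(v) has a smaller part at v, and
-- recolouring v with it decreases the potential. A colouring of minimal potential is balanced.

module Submission where

open import Data.Nat using (ℕ; zero; suc; _+_; _*_; _≤_; _<_; _≥_; _≡ᵇ_; _<?_; z≤n; s≤s; >-nonZero)
open import Data.Nat.Properties
open import Data.Nat.Induction using (<-wellFounded)
open import Data.Nat.Tactic.RingSolver using (solve-∀)
open import Algebra.Properties.CommutativeSemigroup *-commutativeSemigroup
  using () renaming (x∙yz≈y∙xz to *-left-commute)
open import Algebra.Properties.Semiring.Sum +-*-semiring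
  using (sum; sum-syntax; sum-cong-≗; sum-replicate-zero; sum-remove; ∑-comm; ∑-distrib-+; *-distribˡ-sum)
open import Induction.WellFounded using (Acc; acc)
open import Data.Fin using (Fin; zero; suc; punchIn)
import Data.Fin.Properties as FinP
open FinP using (punchInᵢ≢i; any?)
open import Data.Bool using (Bool; true; false; T; if_then_else_)
import Data.Bool.Properties as Bool
open import Data.Unit using (tt)
open import Data.Product using (Σ; ∃; _×_; _,_)
import Data.Product as Product
open import Data.Vec.Functional using (_∷_; updateAt)
open import Data.Vec.Functional.Properties using (updateAt-updates; updateAt-minimal)
open import Function using (const; id; Injective; _∘_)
open import Relation.Binary.PropositionalEquality
open import Relation.Nullary using (yes; no)
open import Relation.Nullary.Decidable using (_×-dec_)
open import Defs

𝟙 : Bool → ℕ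
𝟙 true  = 1
𝟙 false = 0

𝟙-if : ∀ a b → 𝟙 (if a then b else false) ≡ 𝟙 a * 𝟙 b
𝟙-if true  b = sym (*-identityˡ (𝟙 b))
𝟙-if false b = refl

𝟙-true : ∀ {b} x → b ≡ true → 𝟙 b * x ≡ x
𝟙-true x refl = *-identityˡ x

𝟙*-≤ : ∀ b x → 𝟙 b * x ≤ x
𝟙*-≤ true  x = ≤-reflexive (*-identityˡ x)
𝟙*-≤ false x = z≤n

count≡∑𝟙 : ∀ {n} (p : Fin n → Bool) → count p ≡ ∑[ i < n ] 𝟙 (p i)
count≡∑𝟙 {zero}  p = refl
count≡∑𝟙 {suc n} p = cong₂ _+_ (if≡𝟙 (p zero)) (count≡∑𝟙 (λ i → p (suc i)))
  where
  if≡𝟙 : ∀ b → (if b then 1 else 0) ≡ 𝟙 b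
  if≡𝟙 true  = refl
  if≡𝟙 false = refl

∑-mono-≤ : ∀ {n} {f g : Fin n → ℕ} → (∀ i → f i ≤ g i) → ∑[ i < n ] f i ≤ ∑[ i < n ] g i
∑-mono-≤ {zero}  f≤g = z≤n
∑-mono-≤ {suc n} f≤g = +-mono-≤ (f≤g zero) (∑-mono-≤ (λ i → f≤g (suc i)))

∑-linear : ∀ {n} a b (f g : Fin n → ℕ) →
           ∑[ i < n ] (a * f i + b * g i) ≡ a * ∑[ i < n ] f i + b * ∑[ i < n ] g i
∑-linear a b f g = trans (∑-distrib-+ (λ i → a * f i) (λ i → b * g i))
                         (sym (cong₂ _+_ (*-distribˡ-sum a f) (*-distribˡ-sum b g)))

≤-∑ : ∀ {n} (f : Fin n → ℕ) i → f i ≤ ∑[ j < n ] f j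
≤-∑ {suc n} f i = ≤-trans (m≤m+n (f i) _) (≤-reflexive (sym (sum-remove f)))

0<∑ : ∀ {n} (f : Fin n → ℕ) i → 0 < f i → 0 < ∑[ j < n ] f j
0<∑ f i fᵢ>0 = <-≤-trans fᵢ>0 (≤-∑ f i)

AtMostOne : ∀ {k} → (Fin k → Bool) → Set
AtMostOne b = ∀ i j → b i ≡ true → b j ≡ true → i ≡ j

∑𝟙-≤-1 : ∀ {k} (b : Fin k → Bool) → AtMostOne b → ∑[ i < k ] 𝟙 (b i) ≤ 1
∑𝟙-≤-1 {zero}  b _   = z≤n
∑𝟙-≤-1 {suc k} b one with b zero in b₀
... | false = ∑𝟙-≤-1 (λ i → b (suc i)) (λ i j bi bj → FinP.suc-injective (one (suc i) (suc j) bi bj))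
... | true  = s≤s (≤-reflexive (trans (sum-cong-≗ rest-false) (sum-replicate-zero k)))
  where
  rest-false : ∀ i → 𝟙 (b (suc i)) ≡ 0
  rest-false i with b (suc i) in bᵢ
  ... | false = refl
  ... | true  with () ← one zero (suc i) b₀ bᵢ

∑∑-classes-≤ : ∀ {k n} (a : Fin n → ℕ) (b : Fin k → Fin n → Bool) → (∀ u → AtMostOne (λ i → b i u)) →
               ∑[ i < k ] ∑[ u < n ] (a u * 𝟙 (b i u)) ≤ ∑[ u < n ] a u
∑∑-classes-≤ {k} {n} a b one = begin
  ∑[ i < k ] ∑[ u < n ] (a u * 𝟙 (b i u))
    ≡⟨ ∑-comm (λ i u → a u * 𝟙 (b i u)) ⟩
  ∑[ u < n ] ∑[ i < k ] (a u * 𝟙 (b i u))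
    ≡⟨ sum-cong-≗ (λ u → *-distribˡ-sum (a u) (λ i → 𝟙 (b i u))) ⟨
  ∑[ u < n ] (a u * ∑[ i < k ] 𝟙 (b i u))
    ≤⟨ ∑-mono-≤ (λ u → *-monoʳ-≤ (a u) (∑𝟙-≤-1 (λ i → b i u) (one u))) ⟩
  ∑[ u < n ] (a u * 1)
    ≡⟨ sum-cong-≗ (λ u → *-identityʳ (a u)) ⟩
  ∑[ u < n ] a u ∎
  where open ≤-Reasoning

∑<*⇒∃< : ∀ {k} (g : Fin k → ℕ) x → ∑[ i < k ] g i < k * x → ∃ λ i → g i < x
∑<*⇒∃< {suc k} g x ∑<kx with g zero <? x
... | yes g₀<x = zero , g₀<x
... | no  g₀≮x = Product.map suc id (∑<*⇒∃< (λ i → g (suc i)) x rest<kx)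
  where
  rest<kx : ∑[ i < k ] g (suc i) < k * x
  rest<kx = +-cancelˡ-< x _ _ (≤-<-trans (+-monoˡ-≤ _ (≮⇒≥ g₀≮x)) ∑<kx)

cross : ∀ {n} → (Fin n → Fin n → ℕ) → Fin n → ℕ
cross {n} t v = ∑[ w < n ] t v w + ∑[ u < n ] t u v

∑∑-removeAt : ∀ {m} (t : Fin (suc m) → Fin (suc m) → ℕ) v → t v v ≡ 0 →
              ∑[ u < suc m ] ∑[ w < suc m ] t u w
                ≡ cross t v + ∑[ i < m ] ∑[ j < m ] t (punchIn v i) (punchIn v j)
∑∑-removeAt {m} t v tvv≡0 = begin
  ∑[ u < suc m ] ∑[ w < suc m ] t u w
    ≡⟨ sum-remove {i = v} (λ u → ∑[ w < suc m ] t u w) ⟩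
  row + ∑[ i < m ] ∑[ w < suc m ] t (punchIn v i) w
    ≡⟨ cong (row +_) (sum-cong-≗ (λ i → sum-remove {i = v} (t (punchIn v i)))) ⟩
  row + ∑[ i < m ] (t (punchIn v i) v + ∑[ j < m ] t (punchIn v i) (punchIn v j))
    ≡⟨ cong (row +_) (∑-distrib-+ (λ i → t (punchIn v i) v) _) ⟩
  row + (∑[ i < m ] t (punchIn v i) v + off)
    ≡⟨ cong (λ c → row + (c + off)) column ⟨
  row + (∑[ u < suc m ] t u v + off)
    ≡⟨ +-assoc row _ off ⟨
  cross t v + off ∎
  where
  open ≡-Reasoning
  row = ∑[ w < suc m ] t v w
  off = ∑[ i < m ] ∑[ j < m ] t (punchIn v i) (punchIn v j)
  column : ∑[ u < suc m ] t u v ≡ ∑[ i < m ] t (punchIn v i) v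
  column = trans (sum-remove {i = v} (λ u → t u v)) (cong (_+ ∑[ i < m ] t (punchIn v i) v) tvv≡0)

∑∑-agreeOffCross : ∀ {n} (t t′ : Fin n → Fin n → ℕ) v → t v v ≡ 0 → t′ v v ≡ 0 →
                   (∀ u w → u ≢ v → w ≢ v → t u w ≡ t′ u w) →
                   ∑[ u < n ] ∑[ w < n ] t u w + cross t′ v ≡ ∑[ u < n ] ∑[ w < n ] t′ u w + cross t v
∑∑-agreeOffCross {suc m} t t′ v tvv≡0 t′vv≡0 agree = begin
  ∑[ u < suc m ] ∑[ w < suc m ] t u w + cross t′ v    ≡⟨ cong (_+ cross t′ v) (∑∑-removeAt t v tvv≡0) ⟩
  cross t v + off t + cross t′ v                      ≡⟨ cong (λ o → cross t v + o + cross t′ v) off-agree ⟩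
  cross t v + off t′ + cross t′ v                     ≡⟨ swap (cross t v) (off t′) (cross t′ v) ⟩
  cross t′ v + off t′ + cross t v                     ≡⟨ cong (_+ cross t v) (∑∑-removeAt t′ v t′vv≡0) ⟨
  ∑[ u < suc m ] ∑[ w < suc m ] t′ u w + cross t v    ∎
  where
  open ≡-Reasoning
  off : (Fin (suc m) → Fin (suc m) → ℕ) → ℕ
  off s = ∑[ i < m ] ∑[ j < m ] s (punchIn v i) (punchIn v j)
  off-agree : off t ≡ off t′
  off-agree = sum-cong-≗ λ i → sum-cong-≗ λ j → agree _ _ (punchInᵢ≢i v i) (punchInᵢ≢i v j)
  swap : ∀ a o b → a + o + b ≡ b + o + a
  swap = solve-∀

data Walk {n} (p : Fin n → Fin n → ℕ) (S : Fin n → Bool) : Fin n → Fin n → Set where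
  here : ∀ {u} → S u ≡ true → Walk p S u u
  step : ∀ {u w v} → S u ≡ true → 0 < p u w → Walk p S w v → Walk p S u v

walk-source : ∀ {n p S} {u v : Fin n} → Walk p S u v → S u ≡ true
walk-source (here Su)     = Su
walk-source (step Su _ _) = Su

StronglyConnected : ∀ {n} → (Fin n → Fin n → ℕ) → (Fin n → Bool) → Set
StronglyConnected p S = ∀ u v → S u ≡ true → S v ≡ true → Walk p S u v

inflow : ∀ {n} → (Fin n → Fin n → ℕ) → (Fin n → Bool) → (Fin n → ℕ) → Fin n → ℕ
inflow {n} p S π v = ∑[ u < n ] (𝟙 (S u) * (π u * p u v))

outflow : ∀ {n} → (Fin n → Fin n → ℕ) → (Fin n → Bool) → Fin n → ℕ
outflow {n} p S v = ∑[ w < n ] (𝟙 (S w) * p v w)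

Positive : ∀ {n} → (Fin n → Bool) → (Fin n → ℕ) → Set
Positive S π = ∀ v → S v ≡ true → 0 < π v

-- For such π, u ↦ π u * outflow p S u is, up to normalisation, a stationary distribution of
-- the random walk on S that moves from u to v with probability proportional to p u v.
Stationary : ∀ {n} → (Fin n → Fin n → ℕ) → (Fin n → Bool) → (Fin n → ℕ) → Set
Stationary p S π = ∀ v → S v ≡ true → inflow p S π v ≡ π v * outflow p S v

StationaryWeights : ∀ {n} → (Fin n → Fin n → ℕ) → (Fin n → Bool) → Set
StationaryWeights p S = ∃ λ π → Positive S π × Stationary p S π

stationary-singleton : ∀ {n} (p : Fin (suc n) → Fin (suc n) → ℕ) S → (∀ u → S (suc u) ≡ false) →
                       StationaryWeights p S
stationary-singleton {n} p S empty = (λ _ → 1) , (λ _ _ → s≤s z≤n) , stationary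
  where
  open ≡-Reasoning
  rest : (Fin n → ℕ) → ℕ
  rest f = ∑[ u < n ] (𝟙 (S (suc u)) * f u)
  rest≡0 : ∀ f → rest f ≡ 0
  rest≡0 f = trans (sum-cong-≗ (λ u → cong (λ b → 𝟙 b * f u) (empty u))) (sum-replicate-zero n)
  rearrange : ∀ s x → s * (1 * x) + 0 ≡ 1 * (s * x + 0)
  rearrange = solve-∀
  stationary : Stationary p S (λ _ → 1)
  stationary (suc v) Sv with () ← trans (sym (empty v)) Sv
  stationary zero    _  = begin
    𝟙 (S zero) * (1 * p zero zero) + rest (λ u → 1 * p (suc u) zero)
      ≡⟨ cong (𝟙 (S zero) * (1 * p zero zero) +_) (rest≡0 (λ u → 1 * p (suc u) zero)) ⟩
    𝟙 (S zero) * (1 * p zero zero) + 0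
      ≡⟨ rearrange (𝟙 (S zero)) (p zero zero) ⟩
    1 * (𝟙 (S zero) * p zero zero + 0)
      ≡⟨ cong (λ r → 1 * (𝟙 (S zero) * p zero zero + r)) (rest≡0 (λ w → p zero (suc w))) ⟨
    1 * outflow p S zero ∎

module AvoidingZero {n} (p : Fin (suc n) → Fin (suc n) → ℕ) (S : Fin (suc n) → Bool)
                    (S₀ : S zero ≡ false) where

  S⁻ : Fin n → Bool
  S⁻ u = S (suc u)

  p⁻ : Fin n → Fin n → ℕ
  p⁻ u v = p (suc u) (suc v)

  walk-avoiding-zero : ∀ {u v} → Walk p S (suc u) (suc v) → Walk p⁻ S⁻ u v
  walk-avoiding-zero (here Su)                    = here Su
  walk-avoiding-zero (step {w = zero}  _  _ rest) with () ← trans (sym S₀) (walk-source rest)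
  walk-avoiding-zero (step {w = suc w} Su e rest) = step Su e (walk-avoiding-zero rest)

  avoid-zero : StronglyConnected p S → (StronglyConnected p⁻ S⁻ → StationaryWeights p⁻ S⁻) →
               StationaryWeights p S
  avoid-zero sc stationary⁻
    with π , π>0 , stat ← stationary⁻ (λ u v Su Sv → walk-avoiding-zero (sc (suc u) (suc v) Su Sv))
    = (1 ∷ π) , positive , stationary
    where
    positive : Positive S (1 ∷ π)
    positive zero    S₀′ with () ← trans (sym S₀) S₀′
    positive (suc v) Sv = π>0 v Sv
    stationary : Stationary p S (1 ∷ π)
    stationary zero    S₀′ with () ← trans (sym S₀) S₀′
    stationary (suc v) Sv rewrite S₀ = stat v Sv

-- Eliminating vertex zero: an excursion u → zero → v of the walk becomes an edge of p⁻, with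
-- the direct edges scaled by the out-weight q of zero to keep all weights integral. A
-- stationary π for p⁻ lifts by giving zero its π-weighted inflow.
module Elimination {n} (p : Fin (suc n) → Fin (suc n) → ℕ) (S : Fin (suc n) → Bool)
                   (S₀ : S zero ≡ true) where

  S⁻ : Fin n → Bool
  S⁻ u = S (suc u)

  q : ℕ
  q = ∑[ w < n ] (𝟙 (S⁻ w) * p zero (suc w))

  p⁻ : Fin n → Fin n → ℕ
  p⁻ u v = q * p (suc u) (suc v) + p (suc u) zero * p zero (suc v)

  intoZero : (Fin n → ℕ) → ℕ
  intoZero π = ∑[ u < n ] (𝟙 (S⁻ u) * (π u * p (suc u) zero))

  lift : (Fin n → ℕ) → Fin (suc n) → ℕ
  lift π = intoZero π ∷ λ u → q * π u

  private
    𝟙S₀ : 𝟙 (S zero) ≡ 1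
    𝟙S₀ = cong 𝟙 S₀

    ∑-pull-q : ∀ (f g : Fin n → ℕ) →
               ∑[ u < n ] (𝟙 (S⁻ u) * ((q * f u) * g u)) ≡ q * ∑[ u < n ] (𝟙 (S⁻ u) * (f u * g u))
    ∑-pull-q f g = trans (sum-cong-≗ (λ u → pull (𝟙 (S⁻ u)) q (f u) (g u)))
                         (sym (*-distribˡ-sum q (λ u → 𝟙 (S⁻ u) * (f u * g u))))
      where
      pull : ∀ s a x y → s * ((a * x) * y) ≡ a * (s * (x * y))
      pull = solve-∀

  outflow-p⁻ : ∀ v → outflow p⁻ S⁻ v ≡ q * outflow p S (suc v)
  outflow-p⁻ v = begin
    ∑[ w < n ] (𝟙 (S⁻ w) * p⁻ v w)
      ≡⟨ sum-cong-≗ (λ w → spread (𝟙 (S⁻ w)) q (p (suc v) (suc w)) (p (suc v) zero) (p zero (suc w))) ⟩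
    ∑[ w < n ] (q * (𝟙 (S⁻ w) * p (suc v) (suc w)) + p (suc v) zero * (𝟙 (S⁻ w) * p zero (suc w)))
      ≡⟨ ∑-linear q (p (suc v) zero) (λ w → 𝟙 (S⁻ w) * p (suc v) (suc w))
                                      (λ w → 𝟙 (S⁻ w) * p zero (suc w)) ⟩
    q * out + p (suc v) zero * q
      ≡⟨ rearrange q out (p (suc v) zero) ⟩
    q * (1 * p (suc v) zero + out)
      ≡⟨ cong (λ s → q * (s * p (suc v) zero + out)) 𝟙S₀ ⟨
    q * outflow p S (suc v) ∎
    where
    open ≡-Reasoning
    out = ∑[ w < n ] (𝟙 (S⁻ w) * p (suc v) (suc w))
    spread : ∀ s a x y z → s * (a * x + y * z) ≡ a * (s * x) + y * (s * z)
    spread = solve-∀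
    rearrange : ∀ a o x → a * o + x * a ≡ a * (1 * x + o)
    rearrange = solve-∀

  inflow-lift : ∀ π v → inflow p S (lift π) (suc v) ≡ inflow p⁻ S⁻ π v
  inflow-lift π v = begin
    𝟙 (S zero) * (intoZero π * p zero (suc v)) + ∑[ u < n ] (𝟙 (S⁻ u) * ((q * π u) * p (suc u) (suc v)))
      ≡⟨ cong₂ (λ s r → s * (intoZero π * p zero (suc v)) + r) 𝟙S₀
               (∑-pull-q π (λ u → p (suc u) (suc v))) ⟩
    1 * (intoZero π * p zero (suc v)) + q * through
      ≡⟨ rearrange (intoZero π) (p zero (suc v)) q through ⟩
    q * through + p zero (suc v) * intoZero π
      ≡⟨ ∑-linear q (p zero (suc v)) (λ u → 𝟙 (S⁻ u) * (π u * p (suc u) (suc v)))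
                                      (λ u → 𝟙 (S⁻ u) * (π u * p (suc u) zero)) ⟨
    ∑[ u < n ] (q * (𝟙 (S⁻ u) * (π u * p (suc u) (suc v)))
                + p zero (suc v) * (𝟙 (S⁻ u) * (π u * p (suc u) zero)))
      ≡⟨ sum-cong-≗ (λ u → spread (𝟙 (S⁻ u)) (π u) q (p (suc u) (suc v)) (p (suc u) zero)
                                  (p zero (suc v))) ⟨
    ∑[ u < n ] (𝟙 (S⁻ u) * (π u * p⁻ u v)) ∎
    where
    open ≡-Reasoning
    through = ∑[ u < n ] (𝟙 (S⁻ u) * (π u * p (suc u) (suc v)))
    rearrange : ∀ a y c t → 1 * (a * y) + c * t ≡ c * t + y * a
    rearrange = solve-∀
    spread : ∀ s x a y z w → s * (x * (a * y + z * w)) ≡ a * (s * (x * y)) + w * (s * (x * z))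
    spread = solve-∀

  inflow-lift-zero : ∀ π → inflow p S (lift π) zero ≡ lift π zero * outflow p S zero
  inflow-lift-zero π = begin
    𝟙 (S zero) * (A * p zero zero) + ∑[ u < n ] (𝟙 (S⁻ u) * ((q * π u) * p (suc u) zero))
      ≡⟨ cong₂ (λ s r → s * (A * p zero zero) + r) 𝟙S₀ (∑-pull-q π (λ u → p (suc u) zero)) ⟩
    1 * (A * p zero zero) + q * A
      ≡⟨ rearrange A (p zero zero) q ⟩
    A * (1 * p zero zero + q)
      ≡⟨ cong (λ s → A * (s * p zero zero + q)) 𝟙S₀ ⟨
    A * outflow p S zero ∎
    where
    open ≡-Reasoning
    A = intoZero π
    rearrange : ∀ a x c → 1 * (a * x) + c * a ≡ a * (1 * x + c)
    rearrange = solve-∀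

  lift-stationary : ∀ π → Stationary p⁻ S⁻ π → Stationary p S (lift π)
  lift-stationary π stat zero    _  = inflow-lift-zero π
  lift-stationary π stat (suc v) Sv = begin
    inflow p S (lift π) (suc v)    ≡⟨ inflow-lift π v ⟩
    inflow p⁻ S⁻ π v               ≡⟨ stat v Sv ⟩
    π v * outflow p⁻ S⁻ v          ≡⟨ cong (π v *_) (outflow-p⁻ v) ⟩
    π v * (q * outflow p S (suc v)) ≡⟨ *-assoc (π v) q _ ⟨
    π v * q * outflow p S (suc v)   ≡⟨ cong (_* outflow p S (suc v)) (*-comm (π v) q) ⟩
    q * π v * outflow p S (suc v)   ∎
    where open ≡-Reasoning

  lift-positive : ∀ {π} → 0 < q → 0 < intoZero π → Positive S⁻ π → Positive S (lift π)
  lift-positive q>0 A>0 π>0 zero    _  = A>0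
  lift-positive q>0 A>0 π>0 (suc v) Sv = *-mono-≤ q>0 (π>0 v Sv)

  module _ (q>0 : 0 < q) where
    mutual
      shortcut : ∀ {u v} → Walk p S (suc u) (suc v) → Walk p⁻ S⁻ u v
      shortcut (here Su)                     = here Su
      shortcut (step {w = zero}  Su e rest)  = leaveZero Su e rest
      shortcut (step {w = suc w} Su e rest)  = step Su (≤-trans (*-mono-≤ q>0 e) (m≤m+n _ _)) (shortcut rest)

      leaveZero : ∀ {u v} → S⁻ u ≡ true → 0 < p (suc u) zero → Walk p S zero (suc v) → Walk p⁻ S⁻ u v
      leaveZero Su e (step {w = zero}  _ _  rest) = leaveZero Su e rest
      leaveZero Su e (step {w = suc w} _ e′ rest) = step Su (≤-trans (*-mono-≤ e e′) (m≤n+m _ _)) (shortcut rest)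

    shortcut-connected : StronglyConnected p S → StronglyConnected p⁻ S⁻
    shortcut-connected sc u v Su Sv = shortcut (sc (suc u) (suc v) Su Sv)

  exit-from-zero : ∀ {v} → Walk p S zero (suc v) → ∃ λ w → S⁻ w ≡ true × 0 < p zero (suc w)
  exit-from-zero (step {w = zero}  _ _ rest) = exit-from-zero rest
  exit-from-zero (step {w = suc w} _ e rest) = w , walk-source rest , e

  entry-to-zero : ∀ {u} → Walk p S (suc u) zero → ∃ λ w → S⁻ w ≡ true × 0 < p (suc w) zero
  entry-to-zero {u} (step {w = zero}  Su e _)    = u , Su , e
  entry-to-zero     (step {w = suc w} _  _ rest) = entry-to-zero rest

  q-positive : ∀ {y} → StronglyConnected p S → S⁻ y ≡ true → 0 < q
  q-positive {y} sc Sy with exit-from-zero (sc zero (suc y) S₀ Sy)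
  ... | w , Sw , e = 0<∑ (λ w → 𝟙 (S⁻ w) * p zero (suc w)) w (subst (0 <_) (sym (𝟙-true _ Sw)) e)

  intoZero-positive : ∀ {π y} → StronglyConnected p S → Positive S⁻ π → S⁻ y ≡ true → 0 < intoZero π
  intoZero-positive {π} {y} sc π>0 Sy with entry-to-zero (sc (suc y) zero Sy S₀)
  ... | u , Su , e = 0<∑ (λ u → 𝟙 (S⁻ u) * (π u * p (suc u) zero)) u
                         (subst (0 <_) (sym (𝟙-true _ Su)) (*-mono-≤ (π>0 u Su) e))

  eliminate : ∀ {y} → StronglyConnected p S → S⁻ y ≡ true →
              (StronglyConnected p⁻ S⁻ → StationaryWeights p⁻ S⁻) → StationaryWeights p S
  eliminate sc Sy stationary⁻
    with q>0 ← q-positive sc Sy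
    with π , π>0 , stat ← stationary⁻ (shortcut-connected q>0 sc)
    = lift π , lift-positive q>0 (intoZero-positive sc π>0 Sy) π>0 , lift-stationary π stat

stationary-exists : ∀ {n} (p : Fin n → Fin n → ℕ) S → StronglyConnected p S → StationaryWeights p S
stationary-exists {zero}  p S sc = (λ ()) , (λ ()) , (λ ())
stationary-exists {suc n} p S sc with S zero Bool.≟ true | any? (λ y → S (suc y) Bool.≟ true)
... | yes S₀       | yes (y , Sy) = Elimination.eliminate p S S₀ sc Sy (stationary-exists _ _)
... | yes _        | no none      = stationary-singleton p S (λ u → Bool.¬-not (λ Su → none (u , Su)))
... | no S₀≢true   | _            = AvoidingZero.avoid-zero p S (Bool.¬-not S₀≢true) sc (stationary-exists _ _)

adjacency : ∀ {n} → Digraph n → Fin n → Fin n → ℕ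
adjacency G u v = 𝟙 (adj G u v)

≡ᵇ-true⇒≡ : ∀ {m n} → (m ≡ᵇ n) ≡ true → m ≡ n
≡ᵇ-true⇒≡ {m} {n} e = ≡ᵇ⇒≡ m n (subst T (sym e) tt)

module Recolouring {n k} (G : Digraph n) (S : Fin n → Bool) (π : Fin n → ℕ) (π>0 : Positive S π)
  (inflow≤ : ∀ v → S v ≡ true → inflow (adjacency G) S π v ≤ π v * outdeg G v)
  (palette : Fin n → Fin k → ℕ) (palette-injective : ∀ v → S v ≡ true → Injective _≡_ _≡_ (palette v))
  where

  Colouring : Set
  Colouring = Fin n → ℕ

  colour : (Fin n → Fin k) → Colouring
  colour σ v = palette v (σ v)

  weight : Fin n → Fin n → ℕ
  weight u w = 𝟙 (S u) * (π u * adjacency G u w)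

  conflict : Colouring → Fin n → Fin n → ℕ
  conflict C u w = weight u w * 𝟙 (C w ≡ᵇ C u)

  potential : Colouring → ℕ
  potential C = ∑[ u < n ] ∑[ w < n ] conflict C u w

  outWith : Colouring → Fin n → ℕ → ℕ
  outWith C v c = ∑[ w < n ] (adjacency G v w * 𝟙 (C w ≡ᵇ c))

  inWith : Colouring → Fin n → ℕ → ℕ
  inWith C v c = ∑[ u < n ] (weight u v * 𝟙 (c ≡ᵇ C u))

  energy : Colouring → Fin n → ℕ → ℕ
  energy C v c = π v * outWith C v c + inWith C v c

  conflict-loop : ∀ C v → conflict C v v ≡ 0
  conflict-loop C v = trans (cong (λ b → 𝟙 (S v) * (π v * 𝟙 b) * 𝟙 (C v ≡ᵇ C v)) (loopless G v))
                            (vanish (𝟙 (S v)) (π v) (𝟙 (C v ≡ᵇ C v)))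
    where
    vanish : ∀ s x y → s * (x * 0) * y ≡ 0
    vanish = solve-∀

  sameColOut≡outWith : ∀ C v → sameColOut G C v ≡ outWith C v (C v)
  sameColOut≡outWith C v = trans (count≡∑𝟙 (λ w → if adj G v w then C w ≡ᵇ C v else false))
                                 (sum-cong-≗ (λ w → 𝟙-if (adj G v w) (C w ≡ᵇ C v)))

  cross-conflict : ∀ C v → S v ≡ true → cross (conflict C) v ≡ energy C v (C v)
  cross-conflict C v Sv = cong (_+ inWith C v (C v)) (begin
    ∑[ w < n ] (weight v w * 𝟙 (C w ≡ᵇ C v))
      ≡⟨ sum-cong-≗ (λ w → trans (cong (_* 𝟙 (C w ≡ᵇ C v)) (𝟙-true _ Sv)) (*-assoc (π v) _ _)) ⟩
    ∑[ w < n ] (π v * (adjacency G v w * 𝟙 (C w ≡ᵇ C v)))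
      ≡⟨ *-distribˡ-sum (π v) (λ w → adjacency G v w * 𝟙 (C w ≡ᵇ C v)) ⟨
    π v * outWith C v (C v) ∎)
    where open ≡-Reasoning

  adj⇒≢ : ∀ {u w} → adj G u w ≡ true → w ≢ u
  adj⇒≢ {u} e refl with () ← trans (sym e) (loopless G u)

  energy-local : ∀ {C C′ v} → (∀ w → w ≢ v → C′ w ≡ C w) → ∀ c → energy C′ v c ≡ energy C v c
  energy-local {C} {C′} {v} agree c = cong₂ (λ o i → π v * o + i) (sum-cong-≗ out) (sum-cong-≗ in′)
    where
    out : ∀ w → adjacency G v w * 𝟙 (C′ w ≡ᵇ c) ≡ adjacency G v w * 𝟙 (C w ≡ᵇ c)
    out w with adj G v w in e
    ... | false = refl
    ... | true  = cong (λ x → 1 * 𝟙 (x ≡ᵇ c)) (agree w (adj⇒≢ e))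
    in′ : ∀ u → weight u v * 𝟙 (c ≡ᵇ C′ u) ≡ weight u v * 𝟙 (c ≡ᵇ C u)
    in′ u with adj G u v in e
    ... | false rewrite *-zeroʳ (π u) | *-zeroʳ (𝟙 (S u)) = refl
    ... | true  = cong (λ x → 𝟙 (S u) * (π u * 1) * 𝟙 (c ≡ᵇ x)) (agree u (adj⇒≢ e ∘ sym))

  module _ {v} (Sv : S v ≡ true) (C : Colouring) where

    ∑-outWith≤ : ∑[ i < k ] outWith C v (palette v i) ≤ outdeg G v
    ∑-outWith≤ = ≤-trans (∑∑-classes-≤ (adjacency G v) (λ i w → C w ≡ᵇ palette v i) one)
                         (≤-reflexive (sym (count≡∑𝟙 (adj G v))))
      where
      one : ∀ w → AtMostOne (λ i → C w ≡ᵇ palette v i)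
      one w i j eᵢ eⱼ = palette-injective v Sv
                          (trans (sym (≡ᵇ-true⇒≡ {C w} eᵢ)) (≡ᵇ-true⇒≡ {C w} eⱼ))

    ∑-inWith≤ : ∑[ i < k ] inWith C v (palette v i) ≤ π v * outdeg G v
    ∑-inWith≤ = ≤-trans (∑∑-classes-≤ (λ u → weight u v) (λ i u → palette v i ≡ᵇ C u) one)
                        (inflow≤ v Sv)
      where
      one : ∀ u → AtMostOne (λ i → palette v i ≡ᵇ C u)
      one u i j eᵢ eⱼ = palette-injective v Sv (trans (≡ᵇ-true⇒≡ eᵢ) (sym (≡ᵇ-true⇒≡ eⱼ)))

    ∑-energy≤ : ∑[ i < k ] energy C v (palette v i) ≤ 2 * (π v * outdeg G v)
    ∑-energy≤ = begin
      ∑[ i < k ] energy C v (palette v i)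
        ≡⟨ ∑-distrib-+ (λ i → π v * outWith C v (palette v i)) (λ i → inWith C v (palette v i)) ⟩
      ∑[ i < k ] (π v * outWith C v (palette v i)) + ∑[ i < k ] inWith C v (palette v i)
        ≡⟨ cong (_+ ∑[ i < k ] inWith C v (palette v i))
                (*-distribˡ-sum (π v) (λ i → outWith C v (palette v i))) ⟨
      π v * ∑[ i < k ] outWith C v (palette v i) + ∑[ i < k ] inWith C v (palette v i)
        ≤⟨ +-mono-≤ (*-monoʳ-≤ (π v) ∑-outWith≤) ∑-inWith≤ ⟩
      π v * outdeg G v + π v * outdeg G v
        ≡⟨ cong (π v * outdeg G v +_) (+-identityʳ _) ⟨
      2 * (π v * outdeg G v) ∎
      where open ≤-Reasoning

    cheaper-colour : 2 * outdeg G v < k * sameColOut G C v →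
                     ∃ λ i → energy C v (palette v i) < energy C v (C v)
    cheaper-colour violated = ∑<*⇒∃< (λ i → energy C v (palette v i)) (energy C v (C v)) (begin-strict
      ∑[ i < k ] energy C v (palette v i) ≤⟨ ∑-energy≤ ⟩
      2 * (π v * outdeg G v)              ≡⟨ *-left-commute 2 (π v) (outdeg G v) ⟩
      π v * (2 * outdeg G v)              <⟨ *-monoʳ-< (π v) {{>-nonZero (π>0 v Sv)}} violated ⟩
      π v * (k * m)                       ≡⟨ *-left-commute (π v) k m ⟩
      k * (π v * m)                       ≤⟨ *-monoʳ-≤ k own-colour≤energy ⟩
      k * energy C v (C v)                ∎)
      where
      open ≤-Reasoning
      m = sameColOut G C v
      own-colour≤energy : π v * m ≤ energy C v (C v)
      own-colour≤energy = ≤-trans (≤-reflexive (cong (π v *_) (sameColOut≡outWith C v))) (m≤m+n _ _)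

  recolour : (Fin n → Fin k) → Fin n → Fin k → Fin n → Fin k
  recolour σ v i = updateAt σ v (const i)

  recolour-elsewhere : ∀ σ v i w → w ≢ v → colour (recolour σ v i) w ≡ colour σ w
  recolour-elsewhere σ v i w w≢v = cong (palette w) (updateAt-minimal w v σ w≢v)

  recolour-at : ∀ σ v i → colour (recolour σ v i) v ≡ palette v i
  recolour-at σ v i = cong (palette v) (updateAt-updates v σ)

  recolour-decreases : ∀ σ {v} → S v ≡ true → 2 * outdeg G v < k * sameColOut G (colour σ) v →
                       ∃ λ i → potential (colour (recolour σ v i)) < potential (colour σ)
  recolour-decreases σ {v} Sv violated with i , cheaper ← cheaper-colour Sv (colour σ) violated =
    i , +-cancelʳ-< (cross (conflict C) v) (potential C′) (potential C) (begin-strict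
      potential C′ + cross (conflict C) v
        ≡⟨ ∑∑-agreeOffCross (conflict C′) (conflict C) v (conflict-loop C′ v) (conflict-loop C v) agree ⟩
      potential C + cross (conflict C′) v
        ≡⟨ cong (potential C +_) (cross-conflict C′ v Sv) ⟩
      potential C + energy C′ v (C′ v)
        ≡⟨ cong (λ c → potential C + energy C′ v c) (recolour-at σ v i) ⟩
      potential C + energy C′ v (palette v i)
        ≡⟨ cong (potential C +_) (energy-local (recolour-elsewhere σ v i) (palette v i)) ⟩
      potential C + energy C v (palette v i)
        <⟨ +-monoʳ-< (potential C) cheaper ⟩
      potential C + energy C v (C v)
        ≡⟨ cong (potential C +_) (cross-conflict C v Sv) ⟨
      potential C + cross (conflict C) v ∎)
    where
    open ≤-Reasoning
    C C′ : Colouring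
    C  = colour σ
    C′ = colour (recolour σ v i)
    agree : ∀ u w → u ≢ v → w ≢ v → conflict C′ u w ≡ conflict C u w
    agree u w u≢v w≢v = cong₂ (λ x y → weight u w * 𝟙 (x ≡ᵇ y))
                              (recolour-elsewhere σ v i w w≢v) (recolour-elsewhere σ v i u u≢v)

  Balanced : (Fin n → Fin k) → Set
  Balanced σ = ∀ v → S v ≡ true → k * sameColOut G (colour σ) v ≤ 2 * outdeg G v

  balanced-exists : (Fin n → Fin k) → ∃ Balanced
  balanced-exists σ = descend σ (<-wellFounded (potential (colour σ)))
    where
    descend : ∀ σ → Acc _<_ (potential (colour σ)) → ∃ Balanced
    descend σ (acc smaller)
      with any? (λ v → (S v Bool.≟ true) ×-dec (2 * outdeg G v <? k * sameColOut G (colour σ) v))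
    ... | no none = σ , λ v Sv → ≮⇒≥ (λ violated → none (v , Sv , violated))
    ... | yes (v , Sv , violated) with i , lower ← recolour-decreases σ Sv violated =
      descend (recolour σ v i) (smaller lower)

walk-of-path : ∀ {n} {G : Digraph n} {S u v} → PathIn G S u v → Walk (adjacency G) S u v
walk-of-path (here Su)        = here Su
walk-of-path (step Su e rest) = step Su (subst (λ b → 0 < 𝟙 b) (sym e) (s≤s z≤n)) (walk-of-path rest)

inflow≤outdeg : ∀ {n} (G : Digraph n) S π → Stationary (adjacency G) S π →
                ∀ v → S v ≡ true → inflow (adjacency G) S π v ≤ π v * outdeg G v
inflow≤outdeg G S π stationary v Sv = ≤-trans (≤-reflexive (stationary v Sv)) (*-monoʳ-≤ (π v) outflow≤outdeg)
  where
  outflow≤outdeg : outflow (adjacency G) S v ≤ outdeg G v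
  outflow≤outdeg = ≤-trans (∑-mono-≤ (λ w → 𝟙*-≤ (S w) (adjacency G v w)))
                           (≤-reflexive (sym (count≡∑𝟙 (adj G v))))

record Palette (k : ℕ) (X : ℕ → Set) (c : ℕ) (inS : Bool) : Set where
  field
    colours   : Fin k → ℕ
    outside   : inS ≡ false → ∀ i → colours i ≡ c
    injective : inS ≡ true → Injective _≡_ _≡_ colours
    listed    : inS ≡ true → ∀ i → X (colours i)

palette : ∀ {k X} c inS → (inS ≡ true → AtLeast k X) → Palette k X c inS
palette c true  list with f , f-injective , f-listed ← list refl =
  record { colours = f ; outside = λ () ; injective = λ _ → f-injective ; listed = λ _ → f-listed }
palette c false _ =
  record { colours = λ _ → c ; outside = λ _ _ → refl ; injective = λ () ; listed = λ () }

balanced-list-colouring : ∀ {k} n (G : Digraph n) (S : Fin n → Bool) → StronglyConnectedOn G S →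
  (CT : Fin n → ℕ) (L : Fin n → ℕ → Set) → (∀ v → S v ≡ true → AtLeast (suc k) (L v)) →
  Σ (Fin n → ℕ) (λ C →
      (∀ v → S v ≡ false → C v ≡ CT v)
    × (∀ v → S v ≡ true → L v (C v))
    × (∀ v → S v ≡ true → suc k * sameColOut G C v ≤ 2 * outdeg G v))
balanced-list-colouring n G S sc CT L lists
  with π , π>0 , stationary ← stationary-exists (adjacency G) S (λ u v Su Sv → walk-of-path (sc u v Su Sv))
  =
  let palettes : ∀ v → Palette _ (L v) (CT v) (S v)
      palettes v = palette (CT v) (S v) (lists v)
      open Recolouring G S π π>0 (inflow≤outdeg G S π stationary)
                       (λ v → Palette.colours (palettes v)) (λ v → Palette.injective (palettes v))
      σ , balanced = balanced-exists (λ _ → zero)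
  in colour σ
   , (λ v Tv → Palette.outside (palettes v) Tv (σ v))
   , (λ v Sv → Palette.listed (palettes v) Sv (σ v))
   , balanced

lemma2 : (k : ℕ) → k ≥ 2 → (n : ℕ) → (G : Digraph n) → (S : Fin n → Bool)
    → StronglyConnectedOn G S
    → (∀ u v → S u ≡ false → S v ≡ false → adj G u v ≡ false)
    → (∀ u v → S u ≡ false → S v ≡ true → adj G u v ≡ false)
    → (CT : Fin n → ℕ) → (L : Fin n → ℕ → Set)
    → (∀ v → S v ≡ true → AtLeast k (L v))
    → Σ (Fin n → ℕ) (λ C →
        (∀ v → S v ≡ false → C v ≡ CT v)
        × (∀ v → S v ≡ true → L v (C v))
        × (∀ v → S v ≡ true → k * sameColOut G C v ≤ 2 * outdeg G v))
lemma2 zero    ()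
lemma2 (suc k) _ n G S sc _ _ = balanced-list-colouring n G S sc
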